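{- Let $\mathcal{A}=((A_\xi)_{\xi\in I},\mathcal{F})$ be any algebra, let $\eta\in I$ and $J\subseteq I$. If $\mathcal{A}$ is an $\vec e$-Ramsey algebra for some $\vec e\in\Omega^J_\eta$, then $\mathcal{A}$ is an $\vec e\,'$-Ramsey algebra for every $\vec e\,'\in\Omega^J_\eta$.
   Context: An algebra $((A_\xi)_{\xi\in I},\mathcal{F})$ consists of pairwise disjoint nonempty sets $A_\xi$ (phyla) and a family $\mathcal{F}$ of operations, each from a finite product of phyla into a phylum. Orderly terms $\mathrm{OT}(\mathcal{F})$: smallest collection containing $\mathcal{F}$ and all $\mathrm{id}_{A_\xi}$, closed under $f(\bar x_1,\dots,\bar x_k)=g(h_1(\bar x_1),\dots,h_k(\bar x_k))$ for $k$-ary $g\in\mathcal{F}$, orderly terms $h_i$ with codomains matching $g$'s arguments, and consecutive disjoint variable blocks $\bar x_i$. $\vec a\le_\mathcal{F}\vec b$ means there are orderly terms $f_j$ and finite subsequences $\vec b_j$ of $\vec b$ with $\vec a(j)=f_j(\bar b_j)$ for all $j$ and $\vec b_0\ast\vec b_1\ast\cdots$ a subsequence of $\vec b$. A sort is $\vec e\in{}^\omega I$; $\vec a$ is $\vec e$-sorted if $\vec a(n)\in A_{\vec e(n)}$ for all $n$. $\mathrm{FR}^{\vec e}_\mathcal{F}(\vec b)=\{\vec a(0):\vec a\le_\mathcal{F}\vec b,\ \vec a\ \vec e\text{ -sorted}\}$. $\mathcal{A}$ is $\vec e$-Ramsey if for every $\vec e$-sorted $\vec b$ and $X\subseteq A_{\vec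 e(0)}$ there is an $\vec e$-sorted $\vec a\le_\mathcal{F}\vec b$ with $\mathrm{FR}^{\vec e}_\mathcal{F}(\vec a)$ contained in or disjoint from $X$. $\Omega$ is the set of sorts in which every occurring index occurs infinitely often; $\Omega^J$ is the set of $\vec e\in\Omega$ whose set of occurring indices is exactly $J$; $\Omega^J_\eta=\{\vec e\in\Omega^J:\vec e(0)=\eta\}$. -}

module Defs where

open import Data.Nat using (ℕ; _≤_; _<_)
open import Data.List using (List; []; _∷_; _++_; map; [_])
open import Data.List.Relation.Unary.All using (All; []; _∷_)
open import Data.List.Relation.Unary.All.Properties using (++⁻ˡ; ++⁻ʳ)
open import Data.List.Relation.Unary.Linked using (Linked)
open import Data.List.Membership.Propositional using (_∈_)
open import Data.Product using (Σ; ∃; _×_; _,_; proj₁; proj₂)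
open import Data.Sum using (_⊎_)
open import Relation.Nullary using (¬_)
open import Relation.Binary.PropositionalEquality using (_≡_)
open import Function using (_⇔_)

-- An algebra ((A_ξ)_{ξ∈I}, F).  Pairwise disjointness of the phyla is
-- built in: elements of different phyla live in different fibres of Σ I A.
record Algebra : Set₁ where
  field
    I        : Set
    A        : I → Set
    nonempty : (ξ : I) → A ξ
    Op       : Set
    dom      : Op → List I
    cod      : Op → I
    op       : (g : Op) → All A (dom g) → A (cod g)

module _ (𝒜 : Algebra) where
  open Algebra 𝒜

  Elt : Set
  Elt = Σ I A

  Seq : Set
  Seq = ℕ → Elt

  -- Orderly terms, as syntax: OT ds ζ is an orderly term with domain the
  -- product of the phyla listed in ds and codomain A ζ.
  -- Args ds ζs is a tuple (h_1,…,h_k) of orderly terms with codomains ζs whose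
  -- domains, concatenated (consecutive disjoint variable blocks), are ds.
  mutual
    data OT : List I → I → Set where
      idt : (ξ : I) → OT [ ξ ] ξ
      app : {ds : List I} (g : Op) → Args ds (dom g) → OT ds (cod g)

    data Args : List I → List I → Set where
      []  : Args [] []
      _∷_ : {d ds : List I} {ζ : I} {ζs : List I} →
            OT d ζ → Args ds ζs → Args (d ++ ds) (ζ ∷ ζs)

  mutual
    eval : {ds : List I} {ζ : I} → OT ds ζ → All A ds → A ζ
    eval (idt ξ) (x ∷ []) = x
    eval (app g hs) xs = op g (evalArgs hs xs)

    evalArgs : {ds ζs : List I} → Args ds ζs → All A ds → All A ζs
    evalArgs [] xs = []
    evalArgs (_∷_ {d = d} h hs) xs = eval h (++⁻ˡ d xs) ∷ evalArgs hs (++⁻ʳ d xs)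

  toAll : (xs : List Elt) → All A (map proj₁ xs)
  toAll []       = []
  toAll (x ∷ xs) = proj₂ x ∷ toAll xs

  -- The finite subsequence b_j of b is b restricted to the index
  -- list idx j; the condition that b_0 * b_1 * … is a subsequence of b is
  -- that every idx j is strictly increasing and all indices of idx j are
  -- below all indices of idx j' whenever j < j'.
  record _≤F_ (a b : Seq) : Set where
    field
      idx  : ℕ → List ℕ
      term : (j : ℕ) → OT (map proj₁ (map b (idx j))) (proj₁ (a j))
      val  : (j : ℕ) → (proj₁ (a j) , eval (term j) (toAll (map b (idx j)))) ≡ a j
      incr : (j : ℕ) → Linked _<_ (idx j)
      sep  : (j j' : ℕ) → j < j' → (x y : ℕ) → x ∈ idx j → y ∈ idx j' → x < y

  Sort : Set
  Sort = ℕ → I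

  Sorted : Sort → Seq → Set
  Sorted e a = (n : ℕ) → proj₁ (a n) ≡ e n

  FR : (e : Sort) → Seq → A (e 0) → Set
  FR e b x = Σ Seq (λ a → (a ≤F b) × Sorted e a × (a 0 ≡ (e 0 , x)))

  Ramsey : Sort → Set₁
  Ramsey e = (b : Seq) → Sorted e b → (X : A (e 0) → Set) →
    Σ Seq (λ a → Sorted e a × (a ≤F b) ×
      (((x : A (e 0)) → FR e a x → X x) ⊎ ((x : A (e 0)) → FR e a x → ¬ X x)))

  InΩ : Sort → Set
  InΩ e = (n k : ℕ) → Σ ℕ (λ m → (k ≤ m) × (e m ≡ e n))

  InΩJ : (I → Set) → Sort → Set
  InΩJ J e = InΩ e × ((ξ : I) → J ξ ⇔ Σ ℕ (λ n → e n ≡ ξ))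

  InΩJη : (I → Set) → I → Sort → Set
  InΩJη J η e = InΩJ J e × (e 0 ≡ η)

-- If e and e′ lie in Ω^J_η, each is a subsequence of the other that keeps
-- position 0 fixed: every index of one occurs infinitely often in the other.
-- Restricting a sequence to a subsequence of positions preserves ≤_F in
-- both directions, so an e′-sorted b restricts to an e-sorted b ∘ s, the
-- e-Ramsey property gives a homogeneous a ≤_F b ∘ s, and a restricted back
-- along the other subsequence is e′-sorted with FR^{e′} contained in FR^e.
module Submission where

open import Defs
open import Data.Nat using (ℕ; zero; suc; _≤_; _<_)
open import Data.Nat.Properties using (<-trans; m<1+n⇒m<n∨m≡n)
open import Data.List using (List; map)
open import Data.List.Properties using (map-∘)
import Data.List.Relation.Unary.Linked as Linked
open import Data.List.Relation.Unary.Linked.Properties using (map⁺)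
open import Data.List.Membership.Propositional using (_∈_)
open import Data.List.Membership.Propositional.Properties using (∈-map⁻)
open import Data.Product using (Σ; _×_; _,_; proj₁; proj₂)
open import Data.Product.Properties using (Σ-≡,≡→≡)
open import Data.Sum using (_⊎_; inj₁; inj₂)
open import Function using (_∘_; Equivalence)
open import Relation.Nullary using (¬_)
open import Relation.Binary.Core using (_Preserves_⟶_)
open import Relation.Binary.PropositionalEquality
  using (_≡_; refl; sym; trans; cong; subst)
open import Relation.Binary.PropositionalEquality.Properties using (subst-sym-subst)

StrictlyIncreasing : (ℕ → ℕ) → Set
StrictlyIncreasing s = s Preserves _<_ ⟶ _<_

step⇒strictlyIncreasing : {s : ℕ → ℕ} → (∀ n → s n < s (suc n)) → StrictlyIncreasing s
step⇒strictlyIncreasing step {i} {suc j} i<1+j with m<1+n⇒m<n∨m≡n i<1+j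
... | inj₁ i<j  = <-trans (step⇒strictlyIncreasing step i<j) (step j)
... | inj₂ refl = step j

Homogeneous : {B : Set} → (B → Set) → (B → Set) → Set
Homogeneous P X = (∀ x → P x → X x) ⊎ (∀ x → P x → ¬ X x)

homogeneous-pullback : {B C : Set} {P : B → Set} {Q : C → Set} {X : B → Set}
  (f : B → C) (g : C → B) → (∀ x → g (f x) ≡ x) → (∀ x → P x → Q (f x)) →
  Homogeneous Q (X ∘ g) → Homogeneous P X
homogeneous-pullback {X = X} f g g∘f≡id P⇒Qf (inj₁ inside) =
  inj₁ λ x Px → subst X (g∘f≡id x) (inside (f x) (P⇒Qf x Px))
homogeneous-pullback {X = X} f g g∘f≡id P⇒Qf (inj₂ outside) =
  inj₂ λ x Px Xx → outside (f x) (P⇒Qf x Px) (subst X (sym (g∘f≡id x)) Xx)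

module _ (𝒜 : Algebra) where
  open Algebra 𝒜

  ≤F-restrict : {c a : Seq 𝒜} (s : ℕ → ℕ) → StrictlyIncreasing s →
    _≤F_ 𝒜 c a → _≤F_ 𝒜 (c ∘ s) a
  ≤F-restrict s s-strict c≤a = record
    { idx  = idx ∘ s
    ; term = term ∘ s
    ; val  = val ∘ s
    ; incr = incr ∘ s
    ; sep  = λ j j′ j<j′ → sep (s j) (s j′) (s-strict j<j′)
    }
    where open _≤F_ c≤a

  eval-subst : {ζ : I} {xs ys : List (Elt 𝒜)} (xs≡ys : xs ≡ ys) (t : OT 𝒜 (map proj₁ xs) ζ) →
    eval 𝒜 (subst (λ zs → OT 𝒜 (map proj₁ zs) ζ) xs≡ys t) (toAll 𝒜 ys) ≡ eval 𝒜 t (toAll 𝒜 xs)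
  eval-subst refl t = refl

  ≤F-unrestrict : {a b : Seq 𝒜} (s : ℕ → ℕ) → StrictlyIncreasing s →
    _≤F_ 𝒜 a (b ∘ s) → _≤F_ 𝒜 a b
  ≤F-unrestrict {a} {b} s s-strict a≤bs = record
    { idx  = λ j → map s (idx j)
    ; term = λ j → subst (OTfrom j) (map-∘ (idx j)) (term j)
    ; val  = λ j → trans (cong (proj₁ (a j) ,_) (eval-subst (map-∘ (idx j)) (term j))) (val j)
    ; incr = λ j → map⁺ (Linked.map s-strict (incr j))
    ; sep  = sep′
    }
    where
    open _≤F_ a≤bs

    OTfrom : ℕ → List (Elt 𝒜) → Set
    OTfrom j zs = OT 𝒜 (map proj₁ zs) (proj₁ (a j))

    sep′ : (j j′ : ℕ) → j < j′ → (x y : ℕ) → x ∈ map s (idx j) → y ∈ map s (idx j′) → x < y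
    sep′ j j′ j<j′ x y x∈ y∈ with ∈-map⁻ s x∈ | ∈-map⁻ s y∈
    ... | x₀ , x₀∈ , refl | y₀ , y₀∈ , refl = s-strict (sep j j′ j<j′ x₀ y₀ x₀∈ y₀∈)

  record Subsort (e e′ : Sort 𝒜) : Set where
    field
      pos        : ℕ → ℕ
      pos-strict : StrictlyIncreasing pos
      pos-0      : pos 0 ≡ 0
      sort-pos   : ∀ n → e′ (pos n) ≡ e n

    head : e′ 0 ≡ e 0
    head = subst (λ k → e′ k ≡ e 0) pos-0 (sort-pos 0)

    sorted-restrict : (b : Seq 𝒜) → Sorted 𝒜 e′ b → Sorted 𝒜 e (b ∘ pos)
    sorted-restrict b b-sorted n = trans (b-sorted (pos n)) (sort-pos n)

  OccursCofinallyIn : Sort 𝒜 → Sort 𝒜 → Set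
  OccursCofinallyIn e e′ = (n k : ℕ) → Σ ℕ (λ m → (k ≤ m) × (e′ m ≡ e n))

  cofinal⇒subsort : {e e′ : Sort 𝒜} → e′ 0 ≡ e 0 → OccursCofinallyIn e e′ → Subsort e e′
  cofinal⇒subsort {e} {e′} head cofinal = record
    { pos        = pos
    ; pos-strict = step⇒strictlyIncreasing (λ n → proj₁ (proj₂ (next n)))
    ; pos-0      = refl
    ; sort-pos   = sort-pos
    }
    where
    pos : ℕ → ℕ
    next : ∀ n → Σ ℕ (λ m → (suc (pos n) ≤ m) × (e′ m ≡ e (suc n)))
    pos zero    = zero
    pos (suc n) = proj₁ (next n)
    next n = cofinal (suc n) (suc (pos n))

    sort-pos : ∀ n → e′ (pos n) ≡ e n
    sort-pos zero    = head
    sort-pos (suc n) = proj₂ (proj₂ (next n))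

  ΩJ-cofinal : {J : I → Set} {e e′ : Sort 𝒜} → InΩJ 𝒜 J e → InΩJ 𝒜 J e′ → OccursCofinallyIn e e′
  ΩJ-cofinal (_ , e-occurs) (e′-Ω , e′-occurs) n k
    with Equivalence.to (e′-occurs _) (Equivalence.from (e-occurs _) (n , refl))
  ... | m , e′m≡en with e′-Ω m k
  ...   | m′ , k≤m′ , e′m′≡e′m = m′ , k≤m′ , trans e′m′≡e′m e′m≡en

  ΩJη-subsort : {J : I → Set} {η : I} {e e′ : Sort 𝒜} →
    InΩJη 𝒜 J η e → InΩJη 𝒜 J η e′ → Subsort e e′
  ΩJη-subsort (e-ΩJ , e0≡η) (e′-ΩJ , e′0≡η) =
    cofinal⇒subsort (trans e′0≡η (sym e0≡η)) (ΩJ-cofinal e-ΩJ e′-ΩJ)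

  open Subsort using (pos; pos-strict; pos-0; head; sorted-restrict)

  FR-restrict : {e e′ : Sort 𝒜} (ι : Subsort e e′) (κ : Subsort e′ e) {a : Seq 𝒜}
    (x : A (e′ 0)) → FR 𝒜 e′ (a ∘ pos κ) x → FR 𝒜 e a (subst A (head ι) x)
  FR-restrict ι κ x (c , c≤aκ , c-sorted , c0≡x) =
      c ∘ pos ι
    , ≤F-restrict (pos ι) (pos-strict ι) (≤F-unrestrict (pos κ) (pos-strict κ) c≤aκ)
    , sorted-restrict ι c c-sorted
    , trans (cong c (pos-0 ι)) (trans c0≡x (Σ-≡,≡→≡ (head ι , refl)))

  Ramsey-transfer : {e e′ : Sort 𝒜} → Subsort e e′ → Subsort e′ e → Ramsey 𝒜 e → Ramsey 𝒜 e′
  Ramsey-transfer ι κ ramsey b b-sorted X′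
    with ramsey (b ∘ pos ι) (sorted-restrict ι b b-sorted) (X′ ∘ subst A (sym (head ι)))
  ... | a , a-sorted , a≤bι , homogeneous =
      a ∘ pos κ
    , sorted-restrict κ a a-sorted
    , ≤F-restrict (pos κ) (pos-strict κ) (≤F-unrestrict (pos ι) (pos-strict ι) a≤bι)
    , homogeneous-pullback (subst A (head ι)) (subst A (sym (head ι)))
        (λ _ → subst-sym-subst (head ι)) (FR-restrict ι κ) homogeneous

theorem5p7 : (𝒜 : Algebra) (η : Algebra.I 𝒜) (J : Algebra.I 𝒜 → Set) →
    Σ (Sort 𝒜) (λ e → InΩJη 𝒜 J η e × Ramsey 𝒜 e) →
    (e′ : Sort 𝒜) → InΩJη 𝒜 J η e′ → Ramsey 𝒜 e′
theorem5p7 𝒜 η J (e , e-ΩJη , ramsey) e′ e′-ΩJη =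
  Ramsey-transfer 𝒜 (ΩJη-subsort 𝒜 e-ΩJη e′-ΩJη) (ΩJη-subsort 𝒜 e′-ΩJη e-ΩJη) ramsey
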